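{- Let $G$ be a chordal graph, $a\in RN(G)$, $C$ an irredundant component of $G$, and $u,v\in C\cap N(a)$. Then every induced path from $u$ to $v$ in $G[C]$ has all its vertices in $N(a)$. In particular, $G[N(a)\cap C]$ is connected.
   Context: All graphs are finite, simple and undirected; $N(x)$ and $N[x]=N(x)\cup\{x\}$ are the open and closed neighbourhoods of $x$. A vertex $x$ is irredundant if $N[x]$ is inclusion-minimal in $\{N[y]:y\in V(G)\}$, with the convention that among several vertices having the same inclusion-minimal closed neighbourhood exactly one (fixed) is declared irredundant; all other vertices are redundant. $IR(G)$, $RN(G)$ are the sets of irredundant and redundant vertices; an irredundant component is the vertex set of a connected component of $G[IR(G)]$. Chordal means no induced cycle of length at least four. -}

module Defs where

open import Data.Nat using (ℕ; zero; suc; _≤_)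
open import Data.Fin using (Fin; toℕ; inject₁; fromℕ)
open import Data.Product using (Σ; _×_; _,_; ∃)
open import Data.Sum using (_⊎_)
open import Relation.Nullary using (¬_)
open import Relation.Binary.PropositionalEquality using (_≡_)
open import Relation.Binary using (Decidable)
open import Function.Definitions using (Injective)

record Graph : Set₁ where
  field
    n      : ℕ
    E      : Fin n → Fin n → Set
    E?     : Decidable E
    E-sym  : ∀ {x y} → E x y → E y x
    E-irr  : ∀ {x} → ¬ E x x

module _ (G : Graph) where
  open Graph G

  V : Set
  V = Fin n

  InN : V → V → Set
  InN x y = E x y

  InNc : V → V → Set
  InNc x y = (x ≡ y) ⊎ E x y

  NcSub : V → V → Set
  NcSub y x = ∀ z → InNc y z → InNc x z

  NcMinimal : V → Set
  NcMinimal x = ∀ y → NcSub y x → NcSub x y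

  -- A valid choice of irredundant vertices: among the vertices with a
  -- given inclusion-minimal closed neighbourhood, exactly one is chosen.
  record IrrChoice (irr : V → Set) : Set where
    field
      irr-min    : ∀ x → irr x → NcMinimal x
      irr-exists : ∀ x → NcMinimal x →
                   ∃ λ y → irr y × NcSub x y × NcSub y x
      irr-unique : ∀ x y → irr x → irr y → NcSub x y → NcSub y x → x ≡ y

  CycNext : {k : ℕ} → Fin k → Fin k → Set
  CycNext {k} i j = (suc (toℕ i) ≡ toℕ j) ⊎ ((suc (toℕ i) ≡ k) × (toℕ j ≡ 0))

  record InducedCycle (k : ℕ) : Set where
    field
      len≥4  : 4 ≤ k
      vtx    : Fin k → V
      inj    : Injective _≡_ _≡_ vtx
      adj⇒   : ∀ i j → E (vtx i) (vtx j) → CycNext i j ⊎ CycNext j i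
      ⇒adj   : ∀ i j → CycNext i j → E (vtx i) (vtx j)

  Chordal : Set
  Chordal = ∀ k → ¬ InducedCycle k

  PathNext : {m : ℕ} → Fin (suc m) → Fin (suc m) → Set
  PathNext i j = suc (toℕ i) ≡ toℕ j

  record InducedPath (S : V → Set) (u v : V) (m : ℕ) : Set where
    field
      vtx    : Fin (suc m) → V
      inj    : Injective _≡_ _≡_ vtx
      start  : vtx Data.Fin.zero ≡ u
      end    : vtx (fromℕ m) ≡ v
      inS    : ∀ i → S (vtx i)
      adj⇒   : ∀ i j → E (vtx i) (vtx j) → PathNext i j ⊎ PathNext j i
      ⇒adj   : ∀ i j → PathNext i j → E (vtx i) (vtx j)

  record Walk (S : V → Set) (u v : V) (m : ℕ) : Set where
    field
      vtx    : Fin (suc m) → V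
      start  : vtx Data.Fin.zero ≡ u
      end    : vtx (fromℕ m) ≡ v
      inS    : ∀ i → S (vtx i)
      step   : ∀ (i : Fin m) → E (vtx (inject₁ i)) (vtx (Data.Fin.suc i))

  ConnectedSet : (V → Set) → Set
  ConnectedSet S = ∀ u v → S u → S v → ∃ λ m → Walk S u v m

  record IrrComponent (irr : V → Set) (C : V → Set) : Set where
    field
      nonempty : ∃ λ x → C x
      C⊆IR     : ∀ x → C x → irr x
      conn     : ConnectedSet C
      closed   : ∀ x y → C x → irr y → E x y → C y

module Submission where

-- Vertices of C are irredundant, so a ∉ C lies off every path in
-- G[C].  If an induced u–v path left N(a), a maximal stretch of it strictly
-- between two neighbours of a has at least two edges, and closing it up
-- through a gives an induced cycle of length ≥ 4, impossible in a chordal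
-- graph.  For connectivity, a walk in G[C] between two vertices of
-- N(a) ∩ C is shortened (cutting out repetitions, jumping along chords)
-- to an induced path, which by the first part lies in N(a) ∩ C.
--
-- Paths and walks are handled as ℕ-indexed sequences f 0, …, f m, converted
-- from and to the Fin-indexed records of Defs at the end.

open import Defs
open import Data.Nat using (ℕ; zero; suc; _+_; _∸_; _≤_; _<_; z≤n; s≤s; _≤?_; _<?_)
open import Data.Nat.Properties
open import Data.Nat.Induction using (<-rec)
open import Data.Fin using (Fin; toℕ; inject₁; fromℕ; fromℕ<)
import Data.Fin as Fin
open import Data.Fin.Properties using (toℕ-injective; toℕ<n; toℕ≤pred[n]; toℕ-fromℕ; toℕ-fromℕ<; toℕ-inject₁)
open import Data.Product using (Σ; _×_; _,_; ∃; proj₂)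
open import Data.Sum using (_⊎_; inj₁; inj₂; swap) renaming (map to ⊎-map)
open import Function using (_∘_)
open import Data.Empty using (⊥-elim)
open import Relation.Nullary using (¬_; Dec; yes; no)
open import Relation.Nullary.Decidable using (_×-dec_; _⊎-dec_)
open import Relation.Binary.PropositionalEquality
open import Relation.Binary.Definitions using (tri<; tri≈; tri>)
open import Algebra.Properties.CommutativeSemigroup +-commutativeSemigroup using (xy∙z≈xz∙y)

-- The position t of a sequence of length m+1, read as an element of
-- Fin (suc m) (positions past the end are sent to the last one).
clamp : (m t : ℕ) → Fin (suc m)
clamp m       zero    = Fin.zero
clamp zero    (suc t) = Fin.zero
clamp (suc m) (suc t) = Fin.suc (clamp m t)

toℕ-clamp : ∀ m t → t ≤ m → toℕ (clamp m t) ≡ t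
toℕ-clamp m       zero    _         = refl
toℕ-clamp (suc m) (suc t) (s≤s t≤m) = cong suc (toℕ-clamp m t t≤m)

clamp-toℕ : ∀ m (x : Fin (suc m)) → clamp m (toℕ x) ≡ x
clamp-toℕ m       Fin.zero    = refl
clamp-toℕ (suc m) (Fin.suc x) = cong Fin.suc (clamp-toℕ m x)

clamp-fromℕ : ∀ m → clamp m m ≡ fromℕ m
clamp-fromℕ zero    = refl
clamp-fromℕ (suc m) = cong Fin.suc (clamp-fromℕ m)

-- If a decidable Q holds at 0 and at m but fails at some t ≤ m,
-- then t lies strictly inside a stretch [i, i + D] whose ends satisfy Q and
-- whose interior does not; since i < t < i + D, the stretch has D ≥ 2.
module Gap {Q : ℕ → Set} (Q? : ∀ t → Dec (Q t)) where

  record QFreeStretch (m : ℕ) : Set where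
    field
      left width : ℕ
      wide       : 2 ≤ width
      inRange    : left + width ≤ m
      atLeft     : Q left
      atRight    : Q (left + width)
      free       : ∀ p → 0 < p → p < width → ¬ Q (left + p)

  lastBefore : ∀ t → Q 0 → ¬ Q t →
               ∃ λ i → i < t × Q i × (∀ r → i < r → r ≤ t → ¬ Q r)
  lastBefore zero    q₀ ¬qt = ⊥-elim (¬qt q₀)
  lastBefore (suc t) q₀ ¬qt with Q? t
  ... | yes qt = t , ≤-refl , qt , λ r t<r r≤1+t → subst (λ x → ¬ Q x) (≤-antisym t<r r≤1+t) ¬qt
  ... | no ¬qt′ with lastBefore t q₀ ¬qt′
  ... | i , i<t , qi , freeUpTo-t = i , m<n⇒m<1+n i<t , qi , freeUpTo-1+t
    where
    freeUpTo-1+t : ∀ r → i < r → r ≤ suc t → ¬ Q r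
    freeUpTo-1+t r i<r r≤1+t with r ≟ suc t
    ... | yes refl = ¬qt
    ... | no r≢1+t = freeUpTo-t r i<r (≤-pred (≤∧≢⇒< r≤1+t r≢1+t))

  firstAfter : ∀ d t → Q (t + d) → ¬ Q t →
               ∃ λ j → t < j × j ≤ t + d × Q j × (∀ r → t ≤ r → r < j → ¬ Q r)
  firstAfter zero    t qt+0 ¬qt = ⊥-elim (¬qt (subst Q (+-identityʳ t) qt+0))
  firstAfter (suc d) t qt+d ¬qt with Q? (suc t)
  ... | yes q1+t = suc t , ≤-refl , subst (suc t ≤_) (sym (+-suc t d)) (s≤s (m≤m+n t d)) , q1+t ,
                   λ r t≤r r<1+t → subst (λ x → ¬ Q x) (≤-antisym t≤r (≤-pred r<1+t)) ¬qt
  ... | no ¬q1+t with firstAfter d (suc t) (subst Q (+-suc t d) qt+d) ¬q1+t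
  ... | j , 1+t<j , j≤ , qj , freeFrom-1+t = j , <-trans (n<1+n t) 1+t<j , subst (j ≤_) (sym (+-suc t d)) j≤ , qj , freeFrom-t
    where
    freeFrom-t : ∀ r → t ≤ r → r < j → ¬ Q r
    freeFrom-t r t≤r r<j with r ≟ t
    ... | yes refl = ¬qt
    ... | no r≢t = freeFrom-1+t r (≤∧≢⇒< t≤r (r≢t ∘ sym)) r<j

  stretchAround : ∀ m t → t ≤ m → Q 0 → Q m → ¬ Q t → QFreeStretch m
  stretchAround m t t≤m q₀ qm ¬qt with lastBefore t q₀ ¬qt
                                     | firstAfter (m ∸ t) t (subst Q (sym (m+[n∸m]≡n t≤m)) qm) ¬qt
  ... | i , i<t , qi , freeBelow | j , t<j , j≤ , qj , freeAbove = record
    { left = i ; width = D ; wide = wide ; inRange = subst (_≤ m) (sym i+D≡j) j≤m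
    ; atLeft = qi ; atRight = subst Q (sym i+D≡j) qj ; free = free }
    where
    D : ℕ
    D = j ∸ i
    i+D≡j : i + D ≡ j
    i+D≡j = m+[n∸m]≡n (<⇒≤ (<-trans i<t t<j))
    j≤m : j ≤ m
    j≤m = subst (j ≤_) (m+[n∸m]≡n t≤m) j≤
    wide : 2 ≤ D
    wide = +-cancelˡ-≤ i 2 D (subst₂ _≤_ (+-comm 2 i) (sym i+D≡j) (≤-trans (s≤s i<t) t<j))
    free : ∀ p → 0 < p → p < D → ¬ Q (i + p)
    free p 0<p p<D with i + p ≤? t
    ... | yes i+p≤t = freeBelow (i + p) (m<m+n i 0<p) i+p≤t
    ... | no i+p≰t  = freeAbove (i + p) (<⇒≤ (≰⇒> i+p≰t)) (subst (i + p <_) i+D≡j (+-monoʳ-< i p<D))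

module _ (G : Graph) where
  open Graph G

  Steps : (ℕ → V G) → ℕ → Set
  Steps f m = ∀ t → t < m → E (f t) (f (suc t))

  record Chordless (f : ℕ → V G) (m : ℕ) : Set where
    field
      injective        : ∀ s t → s ≤ m → t ≤ m → f s ≡ f t → s ≡ t
      only-consecutive : ∀ s t → s ≤ m → t ≤ m → E (f s) (f t) → suc s ≡ t ⊎ suc t ≡ s

  record SeqWalk (S : V G → Set) (u v : V G) (m : ℕ) : Set where
    field
      seq   : ℕ → V G
      start : seq 0 ≡ u
      end   : seq m ≡ v
      inS   : ∀ t → t ≤ m → S (seq t)
      step  : Steps seq m

  InducedSeqPath : (V G → Set) → V G → V G → ℕ → Set
  InducedSeqPath S u v m = Σ (SeqWalk S u v m) λ w → Chordless (SeqWalk.seq w) m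

  steps-segment : ∀ {f m} → Steps f m → ∀ i D → i + D ≤ m → Steps (λ p → f (i + p)) D
  steps-segment {f} st i D i+D≤m p p<D =
    subst (λ x → E (f (i + p)) (f x)) (sym (+-suc i p)) (st (i + p) (<-≤-trans (+-monoʳ-< i p<D) i+D≤m))

  chordless-segment : ∀ {f m} → Chordless f m → ∀ i D → i + D ≤ m → Chordless (λ p → f (i + p)) D
  chordless-segment {m = m} c i D i+D≤m = record
    { injective = λ p q p≤D q≤D eq → +-cancelˡ-≡ i _ _ (injective (i + p) (i + q) (bound p≤D) (bound q≤D) eq)
    ; only-consecutive = λ p q p≤D q≤D e → ⊎-map (shifted p q) (shifted q p)
        (only-consecutive (i + p) (i + q) (bound p≤D) (bound q≤D) e) }
    where
    open Chordless c
    bound : ∀ {p} → p ≤ D → i + p ≤ m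
    bound p≤D = ≤-trans (+-monoʳ-≤ i p≤D) i+D≤m
    shifted : ∀ p q → suc (i + p) ≡ i + q → suc p ≡ q
    shifted p q eq = +-cancelˡ-≡ i _ _ (trans (+-suc i p) eq)

  CyclicNext : ℕ → ℕ → ℕ → Set
  CyclicNext k p q = (suc p ≡ q) ⊎ ((suc p ≡ k) × (q ≡ 0))

  seqCycle : ∀ k → 4 ≤ k → (h : ℕ → V G) →
    (∀ p q → p < k → q < k → h p ≡ h q → p ≡ q) →
    (∀ p q → p < k → q < k → E (h p) (h q) → CyclicNext k p q ⊎ CyclicNext k q p) →
    (∀ p q → p < k → q < k → CyclicNext k p q → E (h p) (h q)) →
    InducedCycle G k
  seqCycle k 4≤k h inj only-next next = record
    { len≥4 = 4≤k
    ; vtx   = λ x → h (toℕ x)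
    ; inj   = λ {x} {y} eq → toℕ-injective (inj _ _ (toℕ<n x) (toℕ<n y) eq)
    ; adj⇒  = λ x y e → only-next _ _ (toℕ<n x) (toℕ<n y) e
    ; ⇒adj  = λ x y c → next _ _ (toℕ<n x) (toℕ<n y) c }

  apexCycle : ∀ (g : ℕ → V G) D a → Steps g D → Chordless g D → 2 ≤ D →
    (∀ p → p ≤ D → g p ≢ a) → E a (g 0) → E a (g D) →
    (∀ p → 0 < p → p < D → ¬ E a (g p)) → InducedCycle G (suc (suc D))
  apexCycle g D a steps c 2≤D off a-first a-last a-interior =
    seqCycle (suc (suc D)) (s≤s (s≤s 2≤D)) h inj only-next next
    where
    open Chordless c
    h : ℕ → V G
    h zero    = a
    h (suc p) = g p

    apexNeighbour : ∀ q → q ≤ D → E a (g q) → q ≡ 0 ⊎ q ≡ D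
    apexNeighbour zero _ _ = inj₁ refl
    apexNeighbour (suc q) 1+q≤D e with suc q ≟ D
    ... | yes 1+q≡D = inj₂ 1+q≡D
    ... | no 1+q≢D  = ⊥-elim (a-interior (suc q) (s≤s z≤n) (≤∧≢⇒< 1+q≤D 1+q≢D) e)

    apexEdge : ∀ q → q ≤ D → E a (g q) → CyclicNext (suc (suc D)) 0 (suc q) ⊎ CyclicNext (suc (suc D)) (suc q) 0
    apexEdge q q≤D e with apexNeighbour q q≤D e
    ... | inj₁ refl = inj₁ (inj₁ refl)
    ... | inj₂ refl = inj₂ (inj₂ (refl , refl))

    inj : ∀ p q → p < suc (suc D) → q < suc (suc D) → h p ≡ h q → p ≡ q
    inj zero    zero    _                _                _  = refl
    inj zero    (suc q) _                (s≤s (s≤s q≤D)) eq = ⊥-elim (off q q≤D (sym eq))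
    inj (suc p) zero    (s≤s (s≤s p≤D)) _                eq = ⊥-elim (off p p≤D eq)
    inj (suc p) (suc q) (s≤s (s≤s p≤D)) (s≤s (s≤s q≤D)) eq = cong suc (injective p q p≤D q≤D eq)

    only-next : ∀ p q → p < suc (suc D) → q < suc (suc D) → E (h p) (h q) →
                CyclicNext (suc (suc D)) p q ⊎ CyclicNext (suc (suc D)) q p
    only-next zero    zero    _                _                e = ⊥-elim (E-irr e)
    only-next zero    (suc q) _                (s≤s (s≤s q≤D)) e = apexEdge q q≤D e
    only-next (suc p) zero    (s≤s (s≤s p≤D)) _                e = swap (apexEdge p p≤D (E-sym e))
    only-next (suc p) (suc q) (s≤s (s≤s p≤D)) (s≤s (s≤s q≤D)) e =
      ⊎-map (inj₁ ∘ cong suc) (inj₁ ∘ cong suc) (only-consecutive p q p≤D q≤D e)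

    next : ∀ p q → p < suc (suc D) → q < suc (suc D) → CyclicNext (suc (suc D)) p q → E (h p) (h q)
    next zero    .1             _ _                            (inj₁ refl)          = a-first
    next (suc p) .(suc (suc p)) _ (s≤s (s≤s p<D))              (inj₁ refl)          = steps p p<D
    next .(suc D) .0            _ _                            (inj₂ (refl , refl)) = E-sym a-last

  apex-sees-path : Chordal G → ∀ {f m} a → Steps f m → Chordless f m →
    (∀ t → t ≤ m → f t ≢ a) → E a (f 0) → E a (f m) → ∀ t → t ≤ m → E a (f t)
  apex-sees-path chordal {f} {m} a steps c off a-first a-last t t≤m with E? a (f t)
  ... | yes e = e
  ... | no ¬e = ⊥-elim (chordal (suc (suc width)) (apexCycle (λ p → f (left + p)) width a
                  (steps-segment steps left width inRange) (chordless-segment c left width inRange) wide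
                  (λ p p≤D → off (left + p) (≤-trans (+-monoʳ-≤ left p≤D) inRange))
                  (subst (λ x → E a (f x)) (sym (+-identityʳ left)) atLeft) atRight
                  free))
    where
    open Gap (λ r → E? a (f r))
    open QFreeStretch (stretchAround m t t≤m a-first a-last ¬e)

  truncate : ∀ {S u v m} (w : SeqWalk S u v m) s → s ≤ m → SeqWalk.seq w s ≡ v → SeqWalk S u v s
  truncate w s s≤m seq-s≡v = record
    { seq = seq ; start = start ; end = seq-s≡v
    ; inS = λ t t≤s → inS t (≤-trans t≤s s≤m)
    ; step = λ t t<s → step t (<-≤-trans t<s s≤m) }
    where open SeqWalk w

  module Jump {S u v m} (w : SeqWalk S u v m) (p k e : ℕ) (len : suc (p + k) + e ≡ m)
              (jump : E (SeqWalk.seq w p) (SeqWalk.seq w (suc p + e))) where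
    open SeqWalk w

    jumped : ℕ → V G
    jumped r with r ≤? p
    ... | yes _ = seq r
    ... | no _  = seq (r + e)

    jumped-low : ∀ {r} → r ≤ p → jumped r ≡ seq r
    jumped-low {r} r≤p with r ≤? p
    ... | yes _   = refl
    ... | no r≰p  = ⊥-elim (r≰p r≤p)

    jumped-high : ∀ {r} → p < r → jumped r ≡ seq (r + e)
    jumped-high {r} p<r with r ≤? p
    ... | yes r≤p = ⊥-elim (<⇒≱ p<r r≤p)
    ... | no _    = refl

    high-bound : ∀ {r} → r ≤ suc (p + k) → r + e ≤ m
    high-bound r≤ = subst (_ ≤_) len (+-monoˡ-≤ e r≤)

    p≤m : p ≤ m
    p≤m = ≤-trans (m≤m+n p e) (high-bound (≤-trans (m≤m+n p k) (n≤1+n _)))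

    walk : SeqWalk S u v (suc (p + k))
    walk = record
      { seq   = jumped
      ; start = trans (jumped-low z≤n) start
      ; end   = trans (jumped-high (s≤s (m≤m+n p k))) (trans (cong seq len) end)
      ; inS   = inJumped
      ; step  = stepJumped }
      where
      inJumped : ∀ r → r ≤ suc (p + k) → S (jumped r)
      inJumped r r≤ with ≤-<-connex r p
      ... | inj₁ r≤p = subst S (sym (jumped-low r≤p)) (inS r (≤-trans r≤p p≤m))
      ... | inj₂ p<r = subst S (sym (jumped-high p<r)) (inS (r + e) (high-bound r≤))

      stepJumped : Steps jumped (suc (p + k))
      stepJumped r r< with <-cmp r p
      ... | tri< r<p _ _ = subst₂ E (sym (jumped-low (<⇒≤ r<p))) (sym (jumped-low r<p)) (step r (<-≤-trans r<p p≤m))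
      ... | tri≈ _ refl _ = subst₂ E (sym (jumped-low ≤-refl)) (sym (jumped-high ≤-refl)) jump
      ... | tri> _ _ p<r = subst₂ E (sym (jumped-high p<r)) (sym (jumped-high (m<n⇒m<1+n p<r))) (step (r + e) (high-bound r<))

  jumpAlong : ∀ {S u v m} (w : SeqWalk S u v m) p q → suc p < q → q ≤ m →
              E (SeqWalk.seq w p) (SeqWalk.seq w q) → ∃ λ m′ → m′ < m × SeqWalk S u v m′
  jumpAlong {m = m} w p q 1+p<q q≤m jump with m≤n⇒∃[o]m+o≡n 1+p<q | m≤n⇒∃[o]m+o≡n q≤m
  ... | o , 2+p+o≡q | k , q+k≡m = suc (p + k) , shorter , Jump.walk w p k (suc o) len jump′
    where
    open SeqWalk w
    target : suc p + suc o ≡ q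
    target = trans (cong suc (+-suc p o)) 2+p+o≡q
    len : suc (p + k) + suc o ≡ m
    len = trans (cong suc (xy∙z≈xz∙y p k (suc o))) (trans (cong (_+ k) target) q+k≡m)
    shorter : suc (p + k) < m
    shorter = subst (suc (p + k) <_) len (m<m+n (suc (p + k)) (s≤s z≤n))
    jump′ : E (seq p) (seq (suc p + suc o))
    jump′ = subst (λ x → E (seq p) (seq x)) (sym target) jump

  Shortcut : (ℕ → V G) → ℕ → Set
  Shortcut f m = ∃ λ s → s < suc m × ∃ λ t → t < suc m × s < t × (f s ≡ f t ⊎ (suc s < t × E (f s) (f t)))

  shortcut? : ∀ f m → Dec (Shortcut f m)
  shortcut? f m = anyUpTo? (λ s → anyUpTo? (λ t → (s <? t) ×-dec ((f s Fin.≟ f t) ⊎-dec ((suc s <? t) ×-dec E? (f s) (f t)))) (suc m)) (suc m)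

  chordless-if-no-shortcut : ∀ f m → ¬ Shortcut f m → Chordless f m
  chordless-if-no-shortcut f m none = record { injective = injective ; only-consecutive = only-consecutive }
    where
    injective : ∀ s t → s ≤ m → t ≤ m → f s ≡ f t → s ≡ t
    injective s t s≤m t≤m eq with <-cmp s t
    ... | tri< s<t _ _ = ⊥-elim (none (s , s≤s s≤m , t , s≤s t≤m , s<t , inj₁ eq))
    ... | tri≈ _ s≡t _ = s≡t
    ... | tri> _ _ t<s = ⊥-elim (none (t , s≤s t≤m , s , s≤s s≤m , t<s , inj₁ (sym eq)))

    only-consecutive : ∀ s t → s ≤ m → t ≤ m → E (f s) (f t) → suc s ≡ t ⊎ suc t ≡ s
    only-consecutive s t s≤m t≤m e with <-cmp s t
    ... | tri≈ _ refl _ = ⊥-elim (E-irr e)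
    ... | tri< s<t _ _ with suc s ≟ t
    ...   | yes 1+s≡t = inj₁ 1+s≡t
    ...   | no 1+s≢t  = ⊥-elim (none (s , s≤s s≤m , t , s≤s t≤m , s<t , inj₂ (≤∧≢⇒< s<t 1+s≢t , e)))
    only-consecutive s t s≤m t≤m e | tri> _ _ t<s with suc t ≟ s
    ...   | yes 1+t≡s = inj₂ 1+t≡s
    ...   | no 1+t≢s  = ⊥-elim (none (t , s≤s t≤m , s , s≤s s≤m , t<s , inj₂ (≤∧≢⇒< t<s 1+t≢s , E-sym e)))

  shorten : ∀ {S u v m} (w : SeqWalk S u v m) → Shortcut (SeqWalk.seq w) m → ∃ λ m′ → m′ < m × SeqWalk S u v m′
  shorten w (s , _ , t , t<1+m , _ , inj₂ (1+s<t , chord)) = jumpAlong w s t 1+s<t (≤-pred t<1+m) chord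
  shorten w (s , _ , t , t<1+m , s<t , inj₁ same) with m≤n⇒m<n∨m≡n (≤-pred t<1+m)
  ... | inj₁ t<m = jumpAlong w s (suc t) (s≤s s<t) t<m
                     (subst (λ x → E x (SeqWalk.seq w (suc t))) (sym same) (SeqWalk.step w t t<m))
  ... | inj₂ refl = s , s<t , truncate w s (<⇒≤ s<t) (trans same (SeqWalk.end w))

  induced-subpath : ∀ {S u v m} → SeqWalk S u v m → ∃ (InducedSeqPath S u v)
  induced-subpath {S} {u} {v} {m} = <-rec (λ m → SeqWalk S u v m → ∃ (InducedSeqPath S u v)) shortenFrom m
    where
    shortenFrom : ∀ m → (∀ {m′} → m′ < m → SeqWalk S u v m′ → ∃ (InducedSeqPath S u v)) →
                  SeqWalk S u v m → ∃ (InducedSeqPath S u v)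
    shortenFrom m shorter w with shortcut? (SeqWalk.seq w) m
    ... | no none = m , w , chordless-if-no-shortcut (SeqWalk.seq w) m none
    ... | yes sc with shorten w sc
    ... | _ , m′<m , w′ = shorter m′<m w′

  restrict : ∀ {S T : V G → Set} {u v m} (w : SeqWalk S u v m) → (∀ t → t ≤ m → T (SeqWalk.seq w t)) →
             SeqWalk (λ x → S x × T x) u v m
  restrict w inT = record { seq = seq ; start = start ; end = end ; inS = λ t t≤m → inS t t≤m , inT t t≤m ; step = step }
    where open SeqWalk w

  fromInducedPath : ∀ {S u v m} → InducedPath G S u v m → InducedSeqPath S u v m
  fromInducedPath {S} {u} {v} {m} P = walk , chordless
    where
    open InducedPath P
    f : ℕ → V G
    f t = vtx (clamp m t)
    position : ∀ {s t} → s ≤ m → t ≤ m → suc (toℕ (clamp m s)) ≡ toℕ (clamp m t) → suc s ≡ t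
    position {s} {t} s≤m t≤m = subst₂ (λ x y → suc x ≡ y) (toℕ-clamp m s s≤m) (toℕ-clamp m t t≤m)
    walk : SeqWalk S u v m
    walk = record
      { seq = f ; start = start ; end = trans (cong vtx (clamp-fromℕ m)) end
      ; inS = λ t _ → inS (clamp m t)
      ; step = λ t t<m → ⇒adj (clamp m t) (clamp m (suc t))
                           (trans (cong suc (toℕ-clamp m t (<⇒≤ t<m))) (sym (toℕ-clamp m (suc t) t<m))) }
    chordless : Chordless f m
    chordless = record
      { injective = λ s t s≤m t≤m eq →
          trans (sym (toℕ-clamp m s s≤m)) (trans (cong toℕ (inj eq)) (toℕ-clamp m t t≤m))
      ; only-consecutive = λ s t s≤m t≤m e →
          ⊎-map (position s≤m t≤m) (position t≤m s≤m) (adj⇒ (clamp m s) (clamp m t) e) }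

  fromWalk : ∀ {S u v m} → Walk G S u v m → SeqWalk S u v m
  fromWalk {m = m} w = record
    { seq = λ t → vtx (clamp m t) ; start = start ; end = trans (cong vtx (clamp-fromℕ m)) end
    ; inS = λ t _ → inS (clamp m t)
    ; step = λ t t<m → subst₂ E
        (cong vtx (sym (clamp-at (inject₁ (fromℕ< t<m)) (trans (toℕ-inject₁ (fromℕ< t<m)) (toℕ-fromℕ< t<m)))))
        (cong vtx (sym (clamp-at (Fin.suc (fromℕ< t<m)) (cong suc (toℕ-fromℕ< t<m)))))
        (step (fromℕ< t<m)) }
    where
    open Walk w
    clamp-at : ∀ (x : Fin (suc m)) {t} → toℕ x ≡ t → clamp m t ≡ x
    clamp-at x refl = clamp-toℕ m x

  toWalk : ∀ {S u v m} → SeqWalk S u v m → Walk G S u v m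
  toWalk {m = m} w = record
    { vtx = λ x → seq (toℕ x) ; start = start ; end = trans (cong seq (toℕ-fromℕ m)) end
    ; inS = λ x → inS (toℕ x) (toℕ≤pred[n] x)
    ; step = λ i → subst (λ x → E (seq x) (seq (suc (toℕ i)))) (sym (toℕ-inject₁ i)) (step (toℕ i) (toℕ<n i)) }
    where open SeqWalk w

proposition7 : (G : Graph) → Chordal G →
    (irr : Fin (Graph.n G) → Set) → IrrChoice G irr →
    (a : Fin (Graph.n G)) → ¬ irr a →
    (C : Fin (Graph.n G) → Set) → IrrComponent G irr C →
    (u v : Fin (Graph.n G)) → C u → InN G a u → C v → InN G a v →
    ((m : ℕ) (P : InducedPath G C u v m) (i : Fin (ℕ.suc m)) →
    InN G a (InducedPath.vtx P i))
    × ConnectedSet G (λ x → C x × InN G a x)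
proposition7 G chordal _ _ a a-redundant C component u v _ au _ av = path-in-N[a] , N[a]∩C-connected
  where
  open Graph G
  open IrrComponent component

  a∉C : ∀ x → C x → x ≢ a
  a∉C x Cx refl = a-redundant (C⊆IR x Cx)

  sees-all : ∀ {x y m} ((w , c) : InducedSeqPath G C x y m) → E a x → E a y → ∀ t → t ≤ m → E a (SeqWalk.seq w t)
  sees-all (w , c) ax ay = apex-sees-path G chordal a step c (λ t t≤m → a∉C (seq t) (inS t t≤m))
                             (subst (E a) (sym start) ax) (subst (E a) (sym end) ay)
    where open SeqWalk w

  path-in-N[a] : (m : ℕ) (P : InducedPath G C u v m) (i : Fin (suc m)) → E a (InducedPath.vtx P i)
  path-in-N[a] m P i = subst (E a ∘ InducedPath.vtx P) (clamp-toℕ m i)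
                         (sees-all (fromInducedPath G P) au av (toℕ i) (toℕ≤pred[n] i))

  N[a]∩C-connected : ConnectedSet G (λ x → C x × InN G a x)
  N[a]∩C-connected x y (Cx , ax) (Cy , ay) with induced-subpath G (fromWalk G (proj₂ (conn x y Cx Cy)))
  ... | m , p@(w , _) = m , toWalk G (restrict G {T = E a} w (sees-all p ax ay))
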